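{- Let $n,r\ge1$, $m_1,\dots,m_r\ge1$, let $D$ be the distance matrix of the weighted digraph $dC(n;m_1,\dots,m_r)^W$ with all cycle weights $w_j$ nonzero, and let $\mathcal L$ and $\beta$ be as defined in the context. Then $\mathcal LD+I=\beta\mathds{1}^T$.
   Context: $\mathds{1}$ is the all-ones vector. The digraph $dC(n;m_1,\dots,m_r)$ has vertex set $V=\{u_0,\dots,u_n\}\cup\{v_i^{(j)}:1\le j\le r,\ 1\le i\le m_j\}$, edges $u_{i-1}\to u_i$ ($1\le i\le n$) and, for each $j$, the directed path $u_n\to v_1^{(j)}\to\cdots\to v_{m_j}^{(j)}\to u_0$. Write $v_0^{(j)}=u_n$. Real weights: $W_i$ on $u_{i-1}\to u_i$; $W_i^{(j)}$ on $v_{i-1}^{(j)}\to v_i^{(j)}$ ($1\le i\le m_j$); $W_0^{(j)}$ on $v_{m_j}^{(j)}\to u_0$. Set $w_c=\sum_{i=1}^nW_i$, $\widehat w_j=\sum_{i=0}^{m_j}W_i^{(j)}$, $w_j=w_c+\widehat w_j$; cycles indexed so that $w_1\le\cdots\le w_r$. For $x\ne y$, $d(x,y)$ is the minimum total weight of a directed path without repeated vertices from $x$ to $y$, $d(x,x)=0$, $D=[d(x,y)]_{x,y\in V}$. The vector $\beta$ (indexed by $V$): $\beta(u_i)=W_{i+1}/w_1$ ($0\le i\le n-1$), $\beta(u_n)=\sum_{j=1}^r\frac{W_1^{(j)}}{w_j}-\sum_{j=2}^r\frac{\widehat w_j}{w_j}$, $\beta(v_i^{(j)})=W_{i+1}^{(j)}/w_j$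 ($1\le i\le m_j-1$), $\beta(v_{m_j}^{(j)})=W_0^{(j)}/w_j$. Let $A=[A_{xy}]$ with $A_{xy}=1/w_1$ if $x\to y$ is an edge and $x\in\{u_0,\dots,u_{n-1}\}$; $A_{u_nv_1^{(j)}}=1/w_j$ ($1\le j\le r$); $A_{xy}=1/w_j$ if $x\to y$ is an edge and $x=v_i^{(j)}$; $A_{xy}=0$ otherwise. Let $D^{(Out)}$ be diagonal with entries $\sum_yA_{xy}$, $L=D^{(Out)}-A$, and $\widehat L$ the matrix whose only nonzero entries are $\widehat L_{u_nu_0}=\sum_{j=2}^r\frac1{w_j}$ and $\widehat L_{u_nu_n}=-\sum_{j=2}^r\frac1{w_j}$. Set $\mathcal L=L+\widehat L$.
   Formalization: The edge weights $W_i$, $W_i^{(j)}$ and $W_0^{(j)}$ are rational instead of real. -}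

module Defs where

open import Data.Nat as ℕ using (ℕ; zero; suc)
open import Data.Fin as Fin using (Fin; toℕ; fromℕ; inject₁)
open import Data.Rational as ℚ using (ℚ; 0ℚ; 1ℚ; _+_; _-_; _*_; 1/_; ≢-nonZero)
open import Data.List as List using (List; []; _∷_; map; upTo; allFin; concatMap; foldr) renaming (_++_ to _++ₗ_)
open import Data.List.Relation.Unary.Unique.Propositional using (Unique)
open import Data.Product using (Σ; _×_; _,_)
open import Relation.Binary.PropositionalEquality using (_≡_; _≢_)
open import Relation.Nullary using (yes; no; Dec; ¬_)
open import Relation.Nullary.Decidable using (_×-dec_)

sumℚ : List ℚ → ℚ
sumℚ = foldr _+_ 0ℚ

-- total inverse: 1/p for p ≠ 0 (value at 0 irrelevant; only used under w_j ≠ 0)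
inv : ℚ → ℚ
inv p with p ℚ.≟ 0ℚ
... | yes _ = 0ℚ
... | no ne = 1/_ p {{≢-nonZero ne}}

ite : ∀ {P : Set} → Dec P → ℚ → ℚ → ℚ
ite (yes _) a b = a
ite (no _)  a b = b

-- The weighted digraph dC(n; m_1,…,m_r) with r = suc r'.
--  * cycles indexed by j : Fin (suc r')  (Fin.zero is cycle 1)
--  * W i      = W_i              (used for 1 ≤ i ≤ n)
--  * Wb j i   = W_i^{(j)}        (used for 0 ≤ i ≤ m_j)
module DC (n r' : ℕ) (m : Fin (suc r') → ℕ) (W : ℕ → ℚ) (Wb : Fin (suc r') → ℕ → ℚ) where

  -- u i = u_i (0 ≤ i ≤ n);  v j i = v_{i+1}^{(j)} (0 ≤ i < m_j)
  data V : Set where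
    u : Fin (suc n) → V
    v : (j : Fin (suc r')) → Fin (m j) → V

  data Edge : V → V → Set where
    eu    : (i : Fin n) → Edge (u (inject₁ i)) (u (Fin.suc i))
    ebr   : (j : Fin (suc r')) (k : Fin (m j)) → toℕ k ≡ 0 → Edge (u (fromℕ n)) (v j k)
    ev    : (j : Fin (suc r')) (i k : Fin (m j)) → toℕ k ≡ suc (toℕ i) → Edge (v j i) (v j k)
    eback : (j : Fin (suc r')) (i : Fin (m j)) → suc (toℕ i) ≡ m j → Edge (v j i) (u Fin.zero)

  weight : ∀ {x y} → Edge x y → ℚ
  weight (eu i)          = W (suc (toℕ i))
  weight (ebr j k _)     = Wb j (suc (toℕ k))
  weight (ev j i k _)    = Wb j (suc (toℕ k))
  weight (eback j i _)   = Wb j 0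

  data Path : V → V → Set where
    [] : ∀ {x} → Path x x
    _∷_ : ∀ {x y z} → Edge x y → Path y z → Path x z

  vertices : ∀ {x y} → Path x y → List V
  vertices {x} []      = x ∷ []
  vertices {x} (e ∷ p) = x ∷ vertices p

  pathWeight : ∀ {x y} → Path x y → ℚ
  pathWeight []      = 0ℚ
  pathWeight (e ∷ p) = weight e + pathWeight p

  Simple : ∀ {x y} → Path x y → Set
  Simple p = Unique (vertices p)

  IsDistance : (V → V → ℚ) → Set
  IsDistance d =
    (∀ x → d x x ≡ 0ℚ) ×
    (∀ x y → x ≢ y →
       Σ (Path x y) (λ p → Simple p × pathWeight p ≡ d x y) ×
       (∀ (p : Path x y) → Simple p → d x y ℚ.≤ pathWeight p))

  allV : List V
  allV = map u (allFin (suc n)) ++ₗ concatMap (λ j → map (v j) (allFin (m j))) (allFin (suc r'))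

  Σᵥ : (V → ℚ) → ℚ
  Σᵥ f = sumℚ (map f allV)

  wc : ℚ
  wc = sumℚ (map (λ i → W (suc i)) (upTo n))

  ŵ : Fin (suc r') → ℚ
  ŵ j = sumℚ (map (Wb j) (upTo (suc (m j))))

  w : Fin (suc r') → ℚ
  w j = wc + ŵ j

  Σ≥2 : (Fin (suc r') → ℚ) → ℚ
  Σ≥2 f = sumℚ (map (λ j → f (Fin.suc j)) (allFin r'))

  Σall : (Fin (suc r') → ℚ) → ℚ
  Σall f = sumℚ (map f (allFin (suc r')))

  β : V → ℚ
  β (u i) = ite (toℕ i ℕ.≟ n)
              (Σall (λ j → Wb j 1 * inv (w j)) - Σ≥2 (λ j → ŵ j * inv (w j)))
              (W (suc (toℕ i)) * inv (w Fin.zero))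
  β (v j i) = ite (suc (toℕ i) ℕ.≟ m j)
              (Wb j 0 * inv (w j))
              (Wb j (suc (suc (toℕ i))) * inv (w j))

  A : V → V → ℚ
  A (u i) (u k)     = ite (toℕ k ℕ.≟ suc (toℕ i)) (inv (w Fin.zero)) 0ℚ
  A (u i) (v j k)   = ite ((toℕ i ℕ.≟ n) ×-dec (toℕ k ℕ.≟ 0)) (inv (w j)) 0ℚ
  A (v j i) (v l k) = ite ((j Fin.≟ l) ×-dec (toℕ k ℕ.≟ suc (toℕ i))) (inv (w j)) 0ℚ
  A (v j i) (u k)   = ite ((suc (toℕ i) ℕ.≟ m j) ×-dec (toℕ k ℕ.≟ 0)) (inv (w j)) 0ℚ

  _≟ᵥ_ : (x y : V) → Dec (x ≡ y)
  u i ≟ᵥ u k = map′ i k (i Fin.≟ k)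
    where
      open import Relation.Binary.PropositionalEquality using (cong; refl)
      map′ : (i k : Fin (suc n)) → Dec (i ≡ k) → Dec (u i ≡ u k)
      map′ i .i (yes refl) = yes refl
      map′ i k (no ne) = no λ { refl → ne refl }
  u i ≟ᵥ v j k = no λ ()
  v j i ≟ᵥ u k = no λ ()
  v j i ≟ᵥ v l k with j Fin.≟ l
  ... | no ne = no λ { Relation.Binary.PropositionalEquality.refl → ne Relation.Binary.PropositionalEquality.refl }
  ... | yes Relation.Binary.PropositionalEquality.refl with i Fin.≟ k
  ...   | yes Relation.Binary.PropositionalEquality.refl = yes Relation.Binary.PropositionalEquality.refl
  ...   | no ne = no λ { Relation.Binary.PropositionalEquality.refl → ne Relation.Binary.PropositionalEquality.refl }

  Dout : V → ℚ
  Dout x = Σᵥ (λ y → A x y)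

  L : V → V → ℚ
  L x y = ite (x ≟ᵥ y) (Dout x) 0ℚ - A x y

  S : ℚ
  S = Σ≥2 (λ j → inv (w j))

  L̂ : V → V → ℚ
  L̂ (u i) (u k) = ite ((toℕ i ℕ.≟ n) ×-dec (toℕ k ℕ.≟ 0)) S
                    (ite ((toℕ i ℕ.≟ n) ×-dec (toℕ k ℕ.≟ n)) (ℚ.- S) 0ℚ)
  L̂ _ _ = 0ℚ

  𝓛 : V → V → ℚ
  𝓛 x y = L x y + L̂ x y

  I : V → V → ℚ
  I x y = ite (x ≟ᵥ y) 1ℚ 0ℚ

  𝓛D : (V → V → ℚ) → V → V → ℚ
  𝓛D D x y = Σᵥ (λ z → 𝓛 x z * D z y)

{-# OPTIONS --safe #-}
module Submission where

open import Defs
open import Data.Nat using (ℕ; suc; _≤_)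
open import Data.Fin using (Fin)
open import Data.Rational using (ℚ; 0ℚ)
open import Relation.Binary.PropositionalEquality using (_≡_; _≢_)

open import Data.Nat as ℕ using (zero; z≤n; s≤s; _<_)
import Data.Nat.Properties as ℕP
open import Data.Fin as F using (toℕ; fromℕ; fromℕ<)
import Data.Fin.Properties as FP
open import Data.Rational as Q using (1ℚ; _+_; _*_; _-_; -_)
import Data.Rational.Properties as QP
open import Data.Rational.Solver using (module +-*-Solver)
open import Data.List as List using (List; []; _∷_; map; allFin; upTo; concatMap) renaming (_++_ to _++ₗ_)
import Data.List.Properties as LP
open import Data.List.Membership.Propositional using (_∈_; _∉_)
open import Data.List.Relation.Unary.Any using (here; there)
open import Data.List.Relation.Unary.All using ([]; _∷_)
open import Data.List.Relation.Unary.All.Properties using (¬Any⇒All¬; All¬⇒¬Any)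
open import Data.List.Relation.Unary.AllPairs using ([]; _∷_)
open import Data.Product using (Σ; _×_; _,_; proj₁; proj₂)
open import Data.Empty using (⊥-elim)
open import Function using (_∘_; case_of_)
open import Relation.Nullary using (Dec; yes; no; ¬_)
open import Relation.Nullary.Decidable using (_×-dec_)
open import Relation.Binary.PropositionalEquality using (refl; sym; trans; cong; cong₂; subst; module ≡-Reasoning)
open +-*-Solver

-- Every vertex x ≠ uₙ has a single out-edge x → x⁺, so a shortest path from x to y ≠ x begins
-- with it: d(x, y) = W(x → x⁺) + d(x⁺, y).  Following these forced steps along the u-path and the
-- branches determines d, except that from uₙ a shortest path to the u-path leaves through branch 1
-- (ŵ₁ is the least branch weight, as the cycles are ordered by weight), while one to v⁽ˡ⁾ must
-- leave through branch l.  Consequently d(x⁺, x) + W(x → x⁺) is the weight of the cycle through x.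
-- Row x ≠ uₙ of 𝓛 is (δₓ - δₓ₊)/w, so (𝓛D + I)(x, y) = W(x → x⁺)/w = β(x), the case y = x using
-- the cycle weight; row uₙ is evaluated directly for y on the u-path, y = uₙ, and y on a branch.

ite-yes : ∀ {P : Set} (P? : Dec P) {a b : ℚ} → P → ite P? a b ≡ a
ite-yes (yes _) _ = refl
ite-yes (no ¬p) p = ⊥-elim (¬p p)

ite-no : ∀ {P : Set} (P? : Dec P) {a b : ℚ} → ¬ P → ite P? a b ≡ b
ite-no (yes p) ¬p = ⊥-elim (¬p p)
ite-no (no _)  _  = refl

ite-⇔ : ∀ {P Q : Set} (P? : Dec P) (Q? : Dec Q) {a b : ℚ} →
        (P → Q) → (Q → P) → ite P? a b ≡ ite Q? a b
ite-⇔ (yes _) (yes _) _   _   = refl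
ite-⇔ (yes p) (no ¬q) P⇒Q _   = ⊥-elim (¬q (P⇒Q p))
ite-⇔ (no ¬p) (yes q) _   Q⇒P = ⊥-elim (¬p (Q⇒P q))
ite-⇔ (no _)  (no _)  _   _   = refl

ite-* : ∀ {P : Set} (P? : Dec P) (a b c : ℚ) → ite P? a b * c ≡ ite P? (a * c) (b * c)
ite-* (yes _) _ _ _ = refl
ite-* (no _)  _ _ _ = refl

ite-nested : ∀ {P Q : Set} (P? : Dec P) (Q? : Dec Q) (a b : ℚ) → ¬ (P × Q) →
             ite P? a (ite Q? (- b) 0ℚ) ≡ ite P? a 0ℚ - ite Q? b 0ℚ
ite-nested (yes p) (yes q) a b ¬both = ⊥-elim (¬both (p , q))
ite-nested (yes _) (no _)  a b _     = sym (QP.+-identityʳ a)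
ite-nested (no _)  (yes _) a b _     = sym (QP.+-identityˡ (- b))
ite-nested (no _)  (no _)  a b _     = refl

inv-inverseˡ : ∀ p → p ≢ 0ℚ → inv p * p ≡ 1ℚ
inv-inverseˡ p p≢0 with p Q.≟ 0ℚ
... | yes p≡0  = ⊥-elim (p≢0 p≡0)
... | no  p≢0′ = QP.*-inverseˡ p {{Q.≢-nonZero p≢0′}}

p+q≡r⇒q≡r-p : ∀ p q r → p + q ≡ r → q ≡ r - p
p+q≡r⇒q≡r-p p q r p+q≡r = trans (solve 2 (λ p q → q := (p :+ q) :- p) refl p q) (cong (_- p) p+q≡r)

sum-++ : (xs ys : List ℚ) → sumℚ (xs ++ₗ ys) ≡ sumℚ xs + sumℚ ys
sum-++ []       ys = sym (QP.+-identityˡ _)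
sum-++ (x ∷ xs) ys = trans (cong (x +_) (sum-++ xs ys)) (sym (QP.+-assoc x _ _))

module _ {A : Set} where

  sum-map-cong : {f g : A → ℚ} → (∀ a → f a ≡ g a) → ∀ xs → sumℚ (map f xs) ≡ sumℚ (map g xs)
  sum-map-cong f≗g xs = cong sumℚ (LP.map-cong f≗g xs)

  sum-map-zero : {f : A → ℚ} → (∀ a → f a ≡ 0ℚ) → ∀ xs → sumℚ (map f xs) ≡ 0ℚ
  sum-map-zero f≗0 []       = refl
  sum-map-zero f≗0 (x ∷ xs) = cong₂ _+_ (f≗0 x) (sum-map-zero f≗0 xs)

  sum-map-+ : ∀ (f g : A → ℚ) xs →
              sumℚ (map (λ a → f a + g a) xs) ≡ sumℚ (map f xs) + sumℚ (map g xs)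
  sum-map-+ f g []       = refl
  sum-map-+ f g (x ∷ xs) = trans (cong (f x + g x +_) (sum-map-+ f g xs))
    (solve 4 (λ a b c e → (a :+ b) :+ (c :+ e) := (a :+ c) :+ (b :+ e)) refl (f x) (g x) _ _)

  sum-map-- : ∀ (f g : A → ℚ) xs →
              sumℚ (map (λ a → f a - g a) xs) ≡ sumℚ (map f xs) - sumℚ (map g xs)
  sum-map-- f g []       = refl
  sum-map-- f g (x ∷ xs) = trans (cong (f x - g x +_) (sum-map-- f g xs))
    (solve 4 (λ a b c e → (a :- b) :+ (c :- e) := (a :+ c) :- (b :+ e)) refl (f x) (g x) _ _)

  sum-map-*ˡ : ∀ c (f : A → ℚ) xs → sumℚ (map (λ a → c * f a) xs) ≡ c * sumℚ (map f xs)
  sum-map-*ˡ c f []       = sym (QP.*-zeroʳ c)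
  sum-map-*ˡ c f (x ∷ xs) =
    trans (cong (c * f x +_) (sum-map-*ˡ c f xs)) (sym (QP.*-distribˡ-+ c (f x) _))

  sum-map-*-distrib-- : ∀ c (f h : A → ℚ) xs →
    sumℚ (map (λ a → f a * (c - h a)) xs) ≡ sumℚ (map f xs) * c - sumℚ (map (λ a → f a * h a) xs)
  sum-map-*-distrib-- c f h []       = solve 1 (λ c → con 0ℚ := con 0ℚ :* c :- con 0ℚ) refl c
  sum-map-*-distrib-- c f h (x ∷ xs) = trans (cong (f x * (c - h x) +_) (sum-map-*-distrib-- c f h xs))
    (solve 5 (λ c a b s t → a :* (c :- b) :+ (s :* c :- t) := (a :+ s) :* c :- (a :* b :+ t))
           refl c (f x) (h x) _ _)

  sum-map-concatMap : ∀ {B : Set} (f : A → ℚ) (g : B → List A) bs →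
                      sumℚ (map f (concatMap g bs)) ≡ sumℚ (map (λ b → sumℚ (map f (g b))) bs)
  sum-map-concatMap f g []       = refl
  sum-map-concatMap f g (b ∷ bs) = begin
    sumℚ (map f (g b ++ₗ concatMap g bs))               ≡⟨ cong sumℚ (LP.map-++ f (g b) _) ⟩
    sumℚ (map f (g b) ++ₗ map f (concatMap g bs))       ≡⟨ sum-++ (map f (g b)) _ ⟩
    sumℚ (map f (g b)) + sumℚ (map f (concatMap g bs))
      ≡⟨ cong (sumℚ (map f (g b)) +_) (sum-map-concatMap f g bs) ⟩
    sumℚ (map f (g b)) + sumℚ (map (λ b → sumℚ (map f (g b))) bs) ∎
    where open ≡-Reasoning

sum-allFin-suc : ∀ {N} (f : Fin (suc N) → ℚ) →
                 sumℚ (map f (allFin (suc N))) ≡ f F.zero + sumℚ (map (f ∘ F.suc) (allFin N))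
sum-allFin-suc f = cong (λ ts → f F.zero + sumℚ ts)
  (trans (LP.map-tabulate F.suc f) (sym (LP.map-tabulate (λ t → t) _)))

sum-allFin-support : ∀ {N} (k : Fin N) (f : Fin N → ℚ) → (∀ t → t ≢ k → f t ≡ 0ℚ) →
                     sumℚ (map f (allFin N)) ≡ f k
sum-allFin-support {suc N} F.zero f f≡0 = begin
  sumℚ (map f (allFin (suc N)))                      ≡⟨ sum-allFin-suc f ⟩
  f F.zero + sumℚ (map (f ∘ F.suc) (allFin N))
    ≡⟨ cong (f F.zero +_) (sum-map-zero (λ t → f≡0 (F.suc t) λ ()) (allFin N)) ⟩
  f F.zero + 0ℚ                                      ≡⟨ QP.+-identityʳ _ ⟩
  f F.zero ∎
  where open ≡-Reasoning
sum-allFin-support {suc N} (F.suc k) f f≡0 = begin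
  sumℚ (map f (allFin (suc N)))                      ≡⟨ sum-allFin-suc f ⟩
  f F.zero + sumℚ (map (f ∘ F.suc) (allFin N))
    ≡⟨ cong₂ _+_ (f≡0 F.zero λ ()) (sum-allFin-support k (f ∘ F.suc) λ t t≢k → f≡0 (F.suc t) (t≢k ∘ FP.suc-injective)) ⟩
  0ℚ + f (F.suc k)                                   ≡⟨ QP.+-identityˡ _ ⟩
  f (F.suc k) ∎
  where open ≡-Reasoning

sum-upTo-suc : ∀ (f : ℕ → ℚ) k → sumℚ (map f (upTo (suc k))) ≡ sumℚ (map f (upTo k)) + f k
sum-upTo-suc f k = begin
  sumℚ (map f (upTo (suc k)))                 ≡⟨ cong (λ ts → sumℚ (map f ts)) (sym (LP.upTo-∷ʳ k)) ⟩
  sumℚ (map f (upTo k ++ₗ k ∷ []))            ≡⟨ cong sumℚ (LP.map-++ f (upTo k) _) ⟩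
  sumℚ (map f (upTo k) ++ₗ f k ∷ [])          ≡⟨ sum-++ (map f (upTo k)) _ ⟩
  sumℚ (map f (upTo k)) + (f k + 0ℚ)          ≡⟨ cong (sumℚ (map f (upTo k)) +_) (QP.+-identityʳ (f k)) ⟩
  sumℚ (map f (upTo k)) + f k ∎
  where open ≡-Reasoning

sum-upTo-suc′ : ∀ (f : ℕ → ℚ) k → sumℚ (map f (upTo (suc k))) ≡ f 0 + sumℚ (map (f ∘ suc) (upTo k))
sum-upTo-suc′ f k = cong (λ ts → f 0 + sumℚ ts)
  (trans (LP.map-applyUpTo suc f k) (sym (LP.map-applyUpTo (λ t → t) _ k)))

sum-upTo-step : ∀ (f : ℕ → ℚ) {k l} → l ≡ suc k → sumℚ (map f (upTo k)) + f k ≡ sumℚ (map f (upTo l))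
sum-upTo-step f {k} refl = sym (sum-upTo-suc f k)

clampedSuc : ∀ {k} → Fin (suc k) → Fin (suc k)
clampedSuc {zero}  i         = i
clampedSuc {suc k} F.zero    = F.suc F.zero
clampedSuc {suc k} (F.suc i) = F.suc (clampedSuc i)

toℕ-clampedSuc : ∀ {k} (i : Fin (suc k)) → toℕ i < k → toℕ (clampedSuc i) ≡ suc (toℕ i)
toℕ-clampedSuc {suc k} F.zero    _         = refl
toℕ-clampedSuc {suc k} (F.suc i) (s≤s i<k) = cong suc (toℕ-clampedSuc i i<k)

module Graph (n r' : ℕ) (m : Fin (suc r') → ℕ) (W : ℕ → ℚ) (Wb : Fin (suc r') → ℕ → ℚ) where
  open DC n r' m W Wb public

  u₀ uₙ : V
  u₀ = u F.zero
  uₙ = u (fromℕ n)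

  lastInBranch? : ∀ j (i : Fin (m j)) → Dec (suc (toℕ i) ≡ m j)
  lastInBranch? j i = suc (toℕ i) ℕ.≟ m j

  branchSuccessor : ∀ j (i : Fin (m j)) → Dec (suc (toℕ i) ≡ m j) → V
  branchSuccessor j i (yes _)    = u₀
  branchSuccessor j i (no ¬last) = v j (fromℕ< (ℕP.≤∧≢⇒< (FP.toℕ<n i) ¬last))

  -- Every vertex x ≠ uₙ has exactly one out-edge x → next x, of weight nextWeight x.
  -- The value next uₙ = uₙ is junk.
  next : V → V
  next (u i)   = u (clampedSuc i)
  next (v j i) = branchSuccessor j i (lastInBranch? j i)

  nextWeight : V → ℚ
  nextWeight (u i)   = W (suc (toℕ i))
  nextWeight (v j i) = ite (lastInBranch? j i) (Wb j 0) (Wb j (suc (suc (toℕ i))))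

  cycleOf : V → Fin (suc r')
  cycleOf (u _)   = F.zero
  cycleOf (v j _) = j

  u-injective : ∀ {i k} → u i ≡ u k → i ≡ k
  u-injective refl = refl

  u≢uₙ : ∀ {i} → toℕ i < n → u i ≢ uₙ
  u≢uₙ i<n u≡uₙ = ℕP.<-irrefl (trans (cong toℕ (u-injective u≡uₙ)) (FP.toℕ-fromℕ n)) i<n

  toℕ<n : ∀ {i} → u i ≢ uₙ → toℕ i < n
  toℕ<n {i} u≢uₙ = ℕP.≤∧≢⇒< (FP.toℕ≤pred[n] i)
    λ i≡n → u≢uₙ (cong u (FP.toℕ-injective (trans i≡n (sym (FP.toℕ-fromℕ n)))))

  next-u : ∀ {i k} → toℕ k ≡ suc (toℕ i) → next (u i) ≡ u k
  next-u {i} {k} k≡1+i = cong u (FP.toℕ-injective (trans (toℕ-clampedSuc i i<n) (sym k≡1+i)))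
    where i<n = subst (_≤ n) k≡1+i (FP.toℕ≤pred[n] k)

  next-v-inner : ∀ {j i k} → toℕ k ≡ suc (toℕ i) →
                 next (v j i) ≡ v j k × nextWeight (v j i) ≡ Wb j (suc (suc (toℕ i)))
  next-v-inner {j} {i} {k} k≡1+i with lastInBranch? j i
  ... | yes last = ⊥-elim (ℕP.<-irrefl (trans k≡1+i last) (FP.toℕ<n k))
  ... | no _     = cong (v j) (FP.toℕ-injective (trans (FP.toℕ-fromℕ< _) (sym k≡1+i))) , refl

  next-v-last : ∀ {j i} → suc (toℕ i) ≡ m j → next (v j i) ≡ u₀ × nextWeight (v j i) ≡ Wb j 0
  next-v-last {j} {i} last with lastInBranch? j i
  ... | yes _    = refl , refl
  ... | no ¬last = ⊥-elim (¬last last)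

  next-v≡v : ∀ {j i l k} → next (v j i) ≡ v l k → j ≡ l × toℕ k ≡ suc (toℕ i)
  next-v≡v {j} {i} eq with lastInBranch? j i | eq
  ... | yes _ | ()
  ... | no _  | refl = refl , FP.toℕ-fromℕ< _

  next-v≡u : ∀ {j i k} → next (v j i) ≡ u k → suc (toℕ i) ≡ m j × toℕ k ≡ 0
  next-v≡u {j} {i} eq with lastInBranch? j i | eq
  ... | yes last | refl = last , refl
  ... | no _     | ()

  edge-to-next : ∀ {x z} → x ≢ uₙ → (e : Edge x z) → z ≡ next x × weight e ≡ nextWeight x
  edge-to-next _    (eu i)           = sym (next-u (cong suc (sym (FP.toℕ-inject₁ i)))) ,
                                       cong (W ∘ suc) (sym (FP.toℕ-inject₁ i))
  edge-to-next x≢uₙ (ebr _ _ _)      = ⊥-elim (x≢uₙ refl)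
  edge-to-next _    (ev j i k k≡)    = sym (proj₁ (next-v-inner k≡)) ,
                                       trans (cong (Wb j ∘ suc) k≡) (sym (proj₂ (next-v-inner k≡)))
  edge-to-next _    (eback j i last) = sym (proj₁ (next-v-last last)) , sym (proj₂ (next-v-last last))

  next-edge : ∀ x → x ≢ uₙ → Edge x (next x)
  next-edge (u i) u≢uₙ = subst (λ z → Edge z (next z)) (cong u (FP.inject₁-lower₁ i n≢i))
                           (subst (Edge _) (sym (next-u (cong suc (sym (FP.toℕ-inject₁ i′))))) (eu i′))
    where
      n≢i : n ≢ toℕ i
      n≢i n≡i = ℕP.<-irrefl (sym n≡i) (toℕ<n u≢uₙ)
      i′ = F.lower₁ i n≢i
  next-edge (v j i) _ with lastInBranch? j i
  ... | yes last = eback j i last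
  ... | no _     = ev j i _ (FP.toℕ-fromℕ< _)

  start∈vertices : ∀ {a b} (q : Path a b) → a ∈ vertices q
  start∈vertices []      = here refl
  start∈vertices (_ ∷ _) = here refl

  end∈vertices : ∀ {a b} (q : Path a b) → b ∈ vertices q
  end∈vertices []      = here refl
  end∈vertices (_ ∷ q) = there (end∈vertices q)

  laterVertices : ∀ {a b} → Path a b → List V
  laterVertices []      = []
  laterVertices (_ ∷ q) = vertices q

  start∉laterVertices : ∀ {a b} (q : Path a b) → Simple q → a ∉ laterVertices q
  start∉laterVertices []      _         ()
  start∉laterVertices (_ ∷ _) (a∉q ∷ _) = All¬⇒¬Any a∉q

  next∈laterVertices : ∀ {a b z} (q : Path a b) → z ∈ vertices q → z ≢ b → z ≢ uₙ → next z ∈ laterVertices q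
  next∈laterVertices []      (here refl) z≢b _    = ⊥-elim (z≢b refl)
  next∈laterVertices (e ∷ q) (here refl) _   z≢uₙ =
    subst (_∈ vertices q) (proj₁ (edge-to-next z≢uₙ e)) (start∈vertices q)
  next∈laterVertices (e ∷ q) (there z∈q) z≢b z≢uₙ = later⊆vertices q (next∈laterVertices q z∈q z≢b z≢uₙ)
    where
      later⊆vertices : ∀ {a b c} (q : Path a b) → c ∈ laterVertices q → c ∈ vertices q
      later⊆vertices (_ ∷ _) c∈q = there c∈q

  -- A simple path leaving next x never passes through x, since it would then return to next x.
  next-path-avoids : ∀ {x y} (q : Path (next x) y) → Simple q → x ≢ y → x ≢ uₙ → x ∉ vertices q
  next-path-avoids q simple x≢y x≢uₙ x∈q =
    start∉laterVertices q simple (next∈laterVertices q x∈q x≢y x≢uₙ)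

  -- The walk that every path from a to y must begin with: it follows the unique out-edges of
  -- vertices other than y and uₙ.
  data ForcedWalk (y : V) : V → V → Set where
    []   : ∀ {a} → ForcedWalk y a a
    step : ∀ {a a′ b} → a ≢ y → a ≢ uₙ → next a ≡ a′ → ForcedWalk y a′ b → ForcedWalk y a b

  cost : ∀ {y a b} → ForcedWalk y a b → ℚ
  cost []                     = 0ℚ
  cost (step {a = a} _ _ _ w) = nextWeight a + cost w

  infixr 5 _++ᶠ_
  _++ᶠ_ : ∀ {y a b c} → ForcedWalk y a b → ForcedWalk y b c → ForcedWalk y a c
  []                 ++ᶠ w′ = w′
  step a≢y a≢uₙ eq w ++ᶠ w′ = step a≢y a≢uₙ eq (w ++ᶠ w′)

  cost-++ᶠ : ∀ {y a b c} (w : ForcedWalk y a b) (w′ : ForcedWalk y b c) → cost (w ++ᶠ w′) ≡ cost w + cost w′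
  cost-++ᶠ []                     w′ = sym (QP.+-identityˡ _)
  cost-++ᶠ (step {a = a} _ _ _ w) w′ =
    trans (cong (nextWeight a +_) (cost-++ᶠ w w′)) (sym (QP.+-assoc (nextWeight a) _ _))

  forced-prefix : ∀ {y a b} → ForcedWalk y a b → (q : Path a y) → b ∈ vertices q
  forced-prefix []                   q       = start∈vertices q
  forced-prefix (step a≢y _ _ _)     []      = ⊥-elim (a≢y refl)
  forced-prefix (step _ a≢uₙ refl w) (e ∷ q) with edge-to-next a≢uₙ e
  ... | refl , _ = there (forced-prefix w q)

  forced-path-avoids-uₙ : ∀ {y a} → ForcedWalk y a y → y ≢ uₙ → (q : Path a y) → Simple q → uₙ ∉ vertices q
  forced-path-avoids-uₙ []                   y≢uₙ []      _            (here uₙ≡y) = y≢uₙ (sym uₙ≡y)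
  forced-path-avoids-uₙ []                   _    (_ ∷ q) (y∉q ∷ _)    _           = All¬⇒¬Any y∉q (end∈vertices q)
  forced-path-avoids-uₙ (step a≢y _ _ _)     _    []      _            _           = a≢y refl
  forced-path-avoids-uₙ (step _ a≢uₙ refl w) y≢uₙ (e ∷ q) (_ ∷ simple) uₙ∈q with edge-to-next a≢uₙ e | uₙ∈q
  ... | _    , _ | here uₙ≡a   = a≢uₙ (sym uₙ≡a)
  ... | refl , _ | there uₙ∈q′ = forced-path-avoids-uₙ w y≢uₙ q simple uₙ∈q′

  -- x enumerates consecutive vertices of the u-path or of a branch; φ t is the weight of the
  -- path leading to x t.
  IsLine : ∀ {K} → (Fin K → V) → (Fin K → ℚ) → Set
  IsLine {K} x φ = ∀ (s t : Fin K) → toℕ t ≡ suc (toℕ s) →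
                   x s ≢ uₙ × next (x s) ≡ x t × φ s + nextWeight (x s) ≡ φ t

  line-tail : ∀ {K} {x : Fin (suc K) → V} {φ : Fin (suc K) → ℚ} → IsLine x φ → IsLine (x ∘ F.suc) (φ ∘ F.suc)
  line-tail line s t t≡1+s = line (F.suc s) (F.suc t) (cong suc t≡1+s)

  line-walk : ∀ {K} {x : Fin K → V} {φ : Fin K → ℚ} → IsLine x φ → ∀ {y} {i k : Fin K} → i F.≤ k →
              (∀ t → i F.≤ t → t F.< k → x t ≢ y) → Σ (ForcedWalk y (x i) (x k)) λ w → φ i + cost w ≡ φ k
  line-walk {suc K} line {i = F.zero} {F.zero} _ _ = [] , QP.+-identityʳ _
  line-walk {suc (suc K)} {x} {φ} line {y} {F.zero} {F.suc k} _ avoids =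
    step (avoids F.zero z≤n (s≤s z≤n)) x₀≢uₙ next≡x₁ rest , depth
    where
      first = line F.zero (F.suc F.zero) refl
      x₀≢uₙ = proj₁ first
      next≡x₁ = proj₁ (proj₂ first)
      from-x₁ = line-walk (line-tail line) {i = F.zero} {k} z≤n λ t _ t<k → avoids (F.suc t) z≤n (s≤s t<k)
      rest = proj₁ from-x₁
      depth : φ F.zero + (nextWeight (x F.zero) + cost rest) ≡ φ (F.suc k)
      depth = trans (sym (QP.+-assoc (φ F.zero) _ (cost rest)))
                    (trans (cong (_+ cost rest) (proj₂ (proj₂ first))) (proj₂ from-x₁))
  line-walk {suc K} line {i = F.suc i} {F.suc k} (s≤s i≤k) avoids =
    line-walk (line-tail line) i≤k λ t i≤t t<k → avoids (F.suc t) (s≤s i≤t) (s≤s t<k)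

  -- The weights of the paths u₀ → u i and uₙ → v j i.
  uDepth : Fin (suc n) → ℚ
  uDepth i = sumℚ (map (W ∘ suc) (upTo (toℕ i)))

  vDepth : ∀ j → Fin (m j) → ℚ
  vDepth j i = sumℚ (map (Wb j ∘ suc) (upTo (suc (toℕ i))))

  uDepth-uₙ : uDepth (fromℕ n) ≡ wc
  uDepth-uₙ = cong (λ k → sumℚ (map (W ∘ suc) (upTo k))) (FP.toℕ-fromℕ n)

  u-line : IsLine u uDepth
  u-line s t t≡1+s = u≢uₙ s<n , next-u t≡1+s , sum-upTo-step (W ∘ suc) t≡1+s
    where s<n = subst (_≤ n) t≡1+s (FP.toℕ≤pred[n] t)

  branch-line : ∀ j → IsLine (v j) (vDepth j)
  branch-line j s t t≡1+s = (λ ()) , proj₁ (next-v-inner t≡1+s) , depth-step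
    where
      depth-step : vDepth j s + nextWeight (v j s) ≡ vDepth j t
      depth-step = trans (cong (vDepth j s +_) (proj₂ (next-v-inner t≡1+s)))
                         (sum-upTo-step (Wb j ∘ suc) (cong suc t≡1+s))

  Ordered : Set
  Ordered = ∀ (j k : Fin (suc r')) → j F.≤ k → w j Q.≤ w k

  ŵ-minimal : Ordered → ∀ j → ŵ F.zero Q.≤ ŵ j
  ŵ-minimal ordered j = begin
    ŵ F.zero               ≡⟨ solve 2 (λ a c → a := (a :+ c) :- c) refl (ŵ F.zero) wc ⟩
    (ŵ F.zero + wc) - wc   ≡⟨ cong (_- wc) (QP.+-comm (ŵ F.zero) wc) ⟩
    w F.zero - wc          ≤⟨ QP.+-monoˡ-≤ (- wc) (ordered F.zero j z≤n) ⟩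
    w j - wc               ≡⟨ solve 2 (λ a c → (c :+ a) :- c := a) refl (ŵ j) wc ⟩
    ŵ j ∎
    where open QP.≤-Reasoning

  Σᵥ-split : ∀ f → Σᵥ f ≡ sumℚ (map (f ∘ u) (allFin (suc n))) + Σall (λ j → sumℚ (map (f ∘ v j) (allFin (m j))))
  Σᵥ-split f = begin
    sumℚ (map f (us ++ₗ vs))                  ≡⟨ cong sumℚ (LP.map-++ f us vs) ⟩
    sumℚ (map f us ++ₗ map f vs)              ≡⟨ sum-++ (map f us) (map f vs) ⟩
    sumℚ (map f us) + sumℚ (map f vs)
      ≡⟨ cong₂ _+_ (cong sumℚ (sym (LP.map-∘ {g = f} {f = u} (allFin (suc n)))))
                   (sum-map-concatMap f (λ j → map (v j) (allFin (m j))) (allFin (suc r'))) ⟩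
    sumℚ (map (f ∘ u) (allFin (suc n))) + Σall (λ j → sumℚ (map f (map (v j) (allFin (m j)))))
      ≡⟨ cong (sumℚ (map (f ∘ u) (allFin (suc n))) +_)
              (sum-map-cong (λ j → cong sumℚ (sym (LP.map-∘ {g = f} {f = v j} (allFin (m j))))) (allFin (suc r'))) ⟩
    sumℚ (map (f ∘ u) (allFin (suc n))) + Σall (λ j → sumℚ (map (f ∘ v j) (allFin (m j)))) ∎
    where
      open ≡-Reasoning
      us = map u (allFin (suc n))
      vs = concatMap (λ j → map (v j) (allFin (m j))) (allFin (suc r'))

  Σᵥ-support : ∀ a (f : V → ℚ) → (∀ z → z ≢ a → f z ≡ 0ℚ) → Σᵥ f ≡ f a
  Σᵥ-support (u i) f f≡0 = begin
    Σᵥ f                                                                                  ≡⟨ Σᵥ-split f ⟩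
    sumℚ (map (f ∘ u) (allFin (suc n))) + Σall (λ j → sumℚ (map (f ∘ v j) (allFin (m j))))
      ≡⟨ cong₂ _+_ (sum-allFin-support i (f ∘ u) λ k k≢i → f≡0 (u k) (k≢i ∘ u-injective))
                   (sum-map-zero (λ j → sum-map-zero (λ k → f≡0 (v j k) λ ()) (allFin (m j))) (allFin (suc r'))) ⟩
    f (u i) + 0ℚ                                                                          ≡⟨ QP.+-identityʳ _ ⟩
    f (u i) ∎
    where open ≡-Reasoning
  Σᵥ-support (v j i) f f≡0 = begin
    Σᵥ f                                                                                  ≡⟨ Σᵥ-split f ⟩
    sumℚ (map (f ∘ u) (allFin (suc n))) + Σall (λ l → sumℚ (map (f ∘ v l) (allFin (m l))))
      ≡⟨ cong₂ _+_ (sum-map-zero (λ k → f≡0 (u k) λ ()) (allFin (suc n))) (sum-allFin-support j _ other-branch) ⟩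
    0ℚ + sumℚ (map (f ∘ v j) (allFin (m j)))                                              ≡⟨ QP.+-identityˡ _ ⟩
    sumℚ (map (f ∘ v j) (allFin (m j)))
      ≡⟨ sum-allFin-support i (f ∘ v j) (λ k k≢i → f≡0 (v j k) λ { refl → k≢i refl }) ⟩
    f (v j i) ∎
    where
      open ≡-Reasoning
      other-branch : ∀ l → l ≢ j → sumℚ (map (f ∘ v l) (allFin (m l))) ≡ 0ℚ
      other-branch l l≢j = sum-map-zero (λ k → f≡0 (v l k) λ { refl → l≢j refl }) (allFin (m l))

  δ : V → ℚ → V → ℚ
  δ a c z = ite (a ≟ᵥ z) c 0ℚ

  Σᵥ-δ : ∀ a c → Σᵥ (δ a c) ≡ c
  Σᵥ-δ a c = trans (Σᵥ-support a (δ a c) λ z z≢a → ite-no (a ≟ᵥ z) (z≢a ∘ sym)) (ite-yes (a ≟ᵥ a) refl)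

  Σᵥ-δ-* : ∀ a c (g : V → ℚ) → Σᵥ (λ z → δ a c z * g z) ≡ c * g a
  Σᵥ-δ-* a c g = trans (Σᵥ-support a (λ z → δ a c z * g z) vanishes) (cong (_* g a) (ite-yes (a ≟ᵥ a) refl))
    where
      vanishes : ∀ z → z ≢ a → δ a c z * g z ≡ 0ℚ
      vanishes z z≢a = trans (cong (_* g z) (ite-no (a ≟ᵥ z) (z≢a ∘ sym))) (QP.*-zeroˡ (g z))

  A-row : ∀ x → x ≢ uₙ → ∀ z → A x z ≡ δ (next x) (inv (w (cycleOf x))) z
  A-row (u i) u≢uₙ (u k) = ite-⇔ (toℕ k ℕ.≟ suc (toℕ i)) (next (u i) ≟ᵥ u k) next-u
    λ next≡ → trans (sym (cong toℕ (u-injective next≡))) (toℕ-clampedSuc i (toℕ<n u≢uₙ))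
  A-row (u i) u≢uₙ (v j k) =
    trans (ite-no ((toℕ i ℕ.≟ n) ×-dec (toℕ k ℕ.≟ 0)) λ (i≡n , _) → ℕP.<-irrefl i≡n (toℕ<n u≢uₙ))
          (sym (ite-no (next (u i) ≟ᵥ v j k) {inv (w F.zero)} {0ℚ} λ ()))
  A-row (v j i) _ (v l k) = ite-⇔ ((j F.≟ l) ×-dec (toℕ k ℕ.≟ suc (toℕ i))) (next (v j i) ≟ᵥ v l k)
    (λ { (refl , k≡) → proj₁ (next-v-inner k≡) }) next-v≡v
  A-row (v j i) _ (u k) = ite-⇔ ((suc (toℕ i) ℕ.≟ m j) ×-dec (toℕ k ℕ.≟ 0)) (next (v j i) ≟ᵥ u k)
    (λ (last , k≡0) → trans (proj₁ (next-v-last last)) (cong u (FP.toℕ-injective (sym k≡0)))) next-v≡u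

  L̂-row : ∀ x → x ≢ uₙ → ∀ z → L̂ x z ≡ 0ℚ
  L̂-row (u i) u≢uₙ (u k) = trans (ite-no ((toℕ i ℕ.≟ n) ×-dec (toℕ k ℕ.≟ 0)) (i≢n ∘ proj₁))
                                  (ite-no ((toℕ i ℕ.≟ n) ×-dec (toℕ k ℕ.≟ n)) (i≢n ∘ proj₁))
    where i≢n = λ i≡n → ℕP.<-irrefl i≡n (toℕ<n u≢uₙ)
  L̂-row (u _) _ (v _ _) = refl
  L̂-row (v _ _) _ _     = refl

  β-row : ∀ x → x ≢ uₙ → β x ≡ nextWeight x * inv (w (cycleOf x))
  β-row (u i) u≢uₙ = ite-no (toℕ i ℕ.≟ n) λ i≡n → ℕP.<-irrefl i≡n (toℕ<n u≢uₙ)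
  β-row (v j i) _  = sym (ite-* (lastInBranch? j i) (Wb j 0) _ (inv (w j)))

  β-uₙ : β uₙ ≡ Σall (λ j → Wb j 1 * inv (w j)) - Σ≥2 (λ j → ŵ j * inv (w j))
  β-uₙ = ite-yes (toℕ (fromℕ n) ℕ.≟ n) (FP.toℕ-fromℕ n)

  𝓛-row : ∀ x → x ≢ uₙ → (g : V → ℚ) → Σᵥ (λ z → 𝓛 x z * g z) ≡ inv (w (cycleOf x)) * (g x - g (next x))
  𝓛-row x x≢uₙ g = begin
    Σᵥ (λ z → 𝓛 x z * g z)                                       ≡⟨ sum-map-cong expand allV ⟩
    Σᵥ (λ z → δ x c z * g z - δ (next x) c z * g z)              ≡⟨ sum-map-- (λ z → δ x c z * g z) _ allV ⟩
    Σᵥ (λ z → δ x c z * g z) - Σᵥ (λ z → δ (next x) c z * g z)   ≡⟨ cong₂ _-_ (Σᵥ-δ-* x c g) (Σᵥ-δ-* (next x) c g) ⟩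
    c * g x - c * g (next x)
      ≡⟨ solve 3 (λ c a b → c :* a :- c :* b := c :* (a :- b)) refl c (g x) (g (next x)) ⟩
    c * (g x - g (next x)) ∎
    where
      open ≡-Reasoning
      c = inv (w (cycleOf x))
      out-degree : Dout x ≡ c
      out-degree = trans (sum-map-cong (A-row x x≢uₙ) allV) (Σᵥ-δ (next x) c)
      expand : ∀ z → 𝓛 x z * g z ≡ δ x c z * g z - δ (next x) c z * g z
      expand z = begin
        ((δ x (Dout x) z - A x z) + L̂ x z) * g z
          ≡⟨ cong₂ (λ a l → ((δ x a z - A x z) + l) * g z) out-degree (L̂-row x x≢uₙ z) ⟩
        ((δ x c z - A x z) + 0ℚ) * g z
          ≡⟨ cong (λ a → ((δ x c z - a) + 0ℚ) * g z) (A-row x x≢uₙ z) ⟩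
        ((δ x c z - δ (next x) c z) + 0ℚ) * g z
          ≡⟨ solve 3 (λ a b e → ((a :- b) :+ con 0ℚ) :* e := a :* e :- b :* e) refl (δ x c z) (δ (next x) c z) (g z) ⟩
        δ x c z * g z - δ (next x) c z * g z ∎

  module NonTrivial (n≥1 : 1 ≤ n) (m≥1 : ∀ j → 1 ≤ m j) where

    firstIndex : ∀ j → Fin (m j)
    firstIndex j = fromℕ< (m≥1 j)

    firstIndex≤ : ∀ j (i : Fin (m j)) → firstIndex j F.≤ i
    firstIndex≤ j i = subst (ℕ._≤ toℕ i) (sym (FP.toℕ-fromℕ< (m≥1 j))) z≤n

    v₀ : Fin (suc r') → V
    v₀ j = v j (firstIndex j)

    u₀≢uₙ : u₀ ≢ uₙ
    u₀≢uₙ = u≢uₙ n≥1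

    suc-pred-m : ∀ j → suc (ℕ.pred (m j)) ≡ m j
    suc-pred-m j = ℕP.suc-pred (m j) {{ℕ.>-nonZero (m≥1 j)}}

    lastIndex : ∀ j → Fin (m j)
    lastIndex j = fromℕ< (ℕP.≤-reflexive (suc-pred-m j))

    vDepth-v₀ : ∀ j → vDepth j (firstIndex j) ≡ Wb j 1
    vDepth-v₀ j = trans (cong (λ k → sumℚ (map (Wb j ∘ suc) (upTo (suc k)))) (FP.toℕ-fromℕ< (m≥1 j)))
                        (QP.+-identityʳ (Wb j 1))

    ŵ-last : ∀ j i → suc (toℕ i) ≡ m j → ŵ j ≡ vDepth j i + Wb j 0
    ŵ-last j i last = begin
      ŵ j                                               ≡⟨ sum-upTo-suc′ (Wb j) (m j) ⟩
      Wb j 0 + sumℚ (map (Wb j ∘ suc) (upTo (m j)))     ≡⟨ QP.+-comm (Wb j 0) _ ⟩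
      sumℚ (map (Wb j ∘ suc) (upTo (m j))) + Wb j 0
        ≡⟨ cong (λ k → sumℚ (map (Wb j ∘ suc) (upTo k)) + Wb j 0) (sym last) ⟩
      vDepth j i + Wb j 0 ∎
      where open ≡-Reasoning

    exit-walk : ∀ {y} j (i : Fin (m j)) → (∀ t → i F.≤ t → v j t ≢ y) →
                Σ (ForcedWalk y (v j i) u₀) λ w → vDepth j i + cost w ≡ ŵ j
    exit-walk {y} j i avoids = to-last ++ᶠ exit , depth
      where
        open ≡-Reasoning
        ℓ = v j (lastIndex j)
        last : suc (toℕ (lastIndex j)) ≡ m j
        last = trans (cong suc (FP.toℕ-fromℕ< _)) (suc-pred-m j)
        i≤last : i F.≤ lastIndex j
        i≤last = subst (toℕ i ℕ.≤_) (sym (FP.toℕ-fromℕ< _)) (FP.toℕ≤pred[n] i)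
        along = line-walk (branch-line j) {y} {i} {lastIndex j} i≤last λ t i≤t _ → avoids t i≤t
        to-last = proj₁ along
        exit : ForcedWalk y ℓ u₀
        exit = step (avoids (lastIndex j) i≤last) (λ ()) (proj₁ (next-v-last last)) []
        depth : vDepth j i + cost (to-last ++ᶠ exit) ≡ ŵ j
        depth = begin
          vDepth j i + cost (to-last ++ᶠ exit)                ≡⟨ cong (vDepth j i +_) (cost-++ᶠ to-last exit) ⟩
          vDepth j i + (cost to-last + (nextWeight ℓ + 0ℚ))
            ≡⟨ solve 3 (λ a b c → a :+ (b :+ (c :+ con 0ℚ)) := (a :+ b) :+ c) refl (vDepth j i) (cost to-last) (nextWeight ℓ) ⟩
          (vDepth j i + cost to-last) + nextWeight ℓ          ≡⟨ cong₂ _+_ (proj₂ along) (proj₂ (next-v-last last)) ⟩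
          vDepth j (lastIndex j) + Wb j 0                     ≡⟨ sym (ŵ-last j (lastIndex j) last) ⟩
          ŵ j ∎

    branch-edge : ∀ j → Edge uₙ (v₀ j)
    branch-edge j = ebr j _ (FP.toℕ-fromℕ< (m≥1 j))

    edge-from-uₙ : ∀ {x z} → x ≡ uₙ → (e : Edge x z) → Σ (Fin (suc r')) λ j → z ≡ v₀ j × weight e ≡ Wb j 1
    edge-from-uₙ x≡uₙ (eu i) = ⊥-elim (ℕP.<-irrefl i≡n (FP.toℕ<n i))
      where i≡n = trans (sym (FP.toℕ-inject₁ i)) (trans (cong toℕ (u-injective x≡uₙ)) (FP.toℕ-fromℕ n))
    edge-from-uₙ _ (ebr j k k≡0) =
      j , cong (v j) (FP.toℕ-injective (trans k≡0 (sym (FP.toℕ-fromℕ< (m≥1 j))))) , cong (Wb j ∘ suc) k≡0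

    L̂-uₙ : ∀ z → L̂ uₙ z ≡ δ u₀ S z - δ uₙ S z
    L̂-uₙ (v j k) = sym (cong₂ _-_ (ite-no (u₀ ≟ᵥ v j k) {S} {0ℚ} λ ()) (ite-no (uₙ ≟ᵥ v j k) {S} {0ℚ} λ ()))
    L̂-uₙ (u k) = begin
      ite at-u₀? S (ite at-uₙ? (- S) 0ℚ)             ≡⟨ ite-⇔ at-u₀? (u₀ ≟ᵥ u k) to-u₀ from-u₀ ⟩
      ite (u₀ ≟ᵥ u k) S (ite at-uₙ? (- S) 0ℚ)        ≡⟨ cong (ite (u₀ ≟ᵥ u k) S) (ite-⇔ at-uₙ? (uₙ ≟ᵥ u k) to-uₙ from-uₙ) ⟩
      ite (u₀ ≟ᵥ u k) S (ite (uₙ ≟ᵥ u k) (- S) 0ℚ)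
        ≡⟨ ite-nested (u₀ ≟ᵥ u k) (uₙ ≟ᵥ u k) S S (λ (u₀≡ , uₙ≡) → u₀≢uₙ (trans u₀≡ (sym uₙ≡))) ⟩
      ite (u₀ ≟ᵥ u k) S 0ℚ - ite (uₙ ≟ᵥ u k) S 0ℚ ∎
      where
        open ≡-Reasoning
        at-u₀? = (toℕ (fromℕ n) ℕ.≟ n) ×-dec (toℕ k ℕ.≟ 0)
        at-uₙ? = (toℕ (fromℕ n) ℕ.≟ n) ×-dec (toℕ k ℕ.≟ n)
        to-u₀ : toℕ (fromℕ n) ≡ n × toℕ k ≡ 0 → u₀ ≡ u k
        to-u₀ (_ , k≡0) = cong u (FP.toℕ-injective (sym k≡0))
        from-u₀ : u₀ ≡ u k → toℕ (fromℕ n) ≡ n × toℕ k ≡ 0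
        from-u₀ u₀≡ = FP.toℕ-fromℕ n , sym (cong toℕ (u-injective u₀≡))
        to-uₙ : toℕ (fromℕ n) ≡ n × toℕ k ≡ n → uₙ ≡ u k
        to-uₙ (_ , k≡n) = cong u (FP.toℕ-injective (trans (FP.toℕ-fromℕ n) (sym k≡n)))
        from-uₙ : uₙ ≡ u k → toℕ (fromℕ n) ≡ n × toℕ k ≡ n
        from-uₙ uₙ≡ = FP.toℕ-fromℕ n , trans (sym (cong toℕ (u-injective uₙ≡))) (FP.toℕ-fromℕ n)

    A-uₙ-sum : ∀ (g : V → ℚ) → Σᵥ (λ z → A uₙ z * g z) ≡ Σall (λ j → inv (w j) * g (v₀ j))
    A-uₙ-sum g = begin
      Σᵥ (λ z → A uₙ z * g z)                                                   ≡⟨ Σᵥ-split (λ z → A uₙ z * g z) ⟩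
      sumℚ (map (λ k → A uₙ (u k) * g (u k)) (allFin (suc n))) + Σall branch-sum
        ≡⟨ cong₂ _+_ (sum-map-zero path-term (allFin (suc n))) (sum-map-cong branch-sum≡ (allFin (suc r'))) ⟩
      0ℚ + Σall (λ j → inv (w j) * g (v₀ j))                                    ≡⟨ QP.+-identityˡ _ ⟩
      Σall (λ j → inv (w j) * g (v₀ j)) ∎
      where
        open ≡-Reasoning
        branch-sum : Fin (suc r') → ℚ
        branch-sum j = sumℚ (map (λ k → A uₙ (v j k) * g (v j k)) (allFin (m j)))
        path-term : ∀ k → A uₙ (u k) * g (u k) ≡ 0ℚ
        path-term k = trans (cong (_* g (u k)) (ite-no (toℕ k ℕ.≟ suc (toℕ (fromℕ n))) {inv (w F.zero)} {0ℚ} k≢1+n))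
                            (QP.*-zeroˡ (g (u k)))
          where k≢1+n = λ k≡ → ℕP.<-irrefl (trans k≡ (cong suc (FP.toℕ-fromℕ n))) (FP.toℕ<n k)
        first? : ∀ j (k : Fin (m j)) → Dec (toℕ (fromℕ n) ≡ n × toℕ k ≡ 0)
        first? j k = (toℕ (fromℕ n) ℕ.≟ n) ×-dec (toℕ k ℕ.≟ 0)
        off-first : ∀ j k → k ≢ firstIndex j → A uₙ (v j k) * g (v j k) ≡ 0ℚ
        off-first j k k≢ = trans (cong (_* g (v j k)) (ite-no (first? j k) {inv (w j)} {0ℚ} (k≢ ∘ is-first ∘ proj₂)))
                                 (QP.*-zeroˡ (g (v j k)))
          where is-first = λ k≡0 → FP.toℕ-injective (trans k≡0 (sym (FP.toℕ-fromℕ< (m≥1 j))))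
        branch-sum≡ : ∀ j → branch-sum j ≡ inv (w j) * g (v₀ j)
        branch-sum≡ j = trans (sum-allFin-support (firstIndex j) (λ k → A uₙ (v j k) * g (v j k)) (off-first j))
                              (cong (_* g (v₀ j)) (ite-yes (first? j (firstIndex j)) (FP.toℕ-fromℕ n , FP.toℕ-fromℕ< (m≥1 j))))

    𝓛-row-uₙ : ∀ (g : V → ℚ) →
               Σᵥ (λ z → 𝓛 uₙ z * g z) ≡ Σall (λ j → inv (w j) * (g uₙ - g (v₀ j))) + S * (g u₀ - g uₙ)
    𝓛-row-uₙ g = begin
      Σᵥ (λ z → 𝓛 uₙ z * g z)                                                  ≡⟨ sum-map-cong expand allV ⟩
      Σᵥ (λ z → (δg uₙ (Dout uₙ) z - Ag z) + (δg u₀ S z - δg uₙ S z))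
        ≡⟨ sum-map-+ (λ z → δg uₙ (Dout uₙ) z - Ag z) (λ z → δg u₀ S z - δg uₙ S z) allV ⟩
      Σᵥ (λ z → δg uₙ (Dout uₙ) z - Ag z) + Σᵥ (λ z → δg u₀ S z - δg uₙ S z)
        ≡⟨ cong₂ _+_ (sum-map-- (δg uₙ (Dout uₙ)) Ag allV) (sum-map-- (δg u₀ S) (δg uₙ S) allV) ⟩
      (Σᵥ (δg uₙ (Dout uₙ)) - Σᵥ Ag) + (Σᵥ (δg u₀ S) - Σᵥ (δg uₙ S))
        ≡⟨ cong₂ _+_ (cong₂ _-_ (trans (Σᵥ-δ-* uₙ (Dout uₙ) g) (cong (_* g uₙ) out-degree)) (A-uₙ-sum g))
                     (cong₂ _-_ (Σᵥ-δ-* u₀ S g) (Σᵥ-δ-* uₙ S g)) ⟩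
      (Σall (λ j → inv (w j)) * g uₙ - Σall (λ j → inv (w j) * g (v₀ j))) + (S * g u₀ - S * g uₙ)
        ≡⟨ cong₂ _+_ (sym (sum-map-*-distrib-- (g uₙ) (λ j → inv (w j)) (g ∘ v₀) (allFin (suc r'))))
                     (solve 3 (λ s a b → s :* a :- s :* b := s :* (a :- b)) refl S (g u₀) (g uₙ)) ⟩
      Σall (λ j → inv (w j) * (g uₙ - g (v₀ j))) + S * (g u₀ - g uₙ) ∎
      where
        open ≡-Reasoning
        δg : V → ℚ → V → ℚ
        δg a c z = δ a c z * g z
        Ag : V → ℚ
        Ag z = A uₙ z * g z
        out-degree : Dout uₙ ≡ Σall (λ j → inv (w j))
        out-degree = trans (sum-map-cong (λ z → sym (QP.*-identityʳ (A uₙ z))) allV)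
                           (trans (A-uₙ-sum (λ _ → 1ℚ)) (sum-map-cong (λ j → QP.*-identityʳ (inv (w j))) (allFin (suc r'))))
        expand : ∀ z → 𝓛 uₙ z * g z ≡ (δg uₙ (Dout uₙ) z - Ag z) + (δg u₀ S z - δg uₙ S z)
        expand z = trans (cong (λ l → ((δ uₙ (Dout uₙ) z - A uₙ z) + l) * g z) (L̂-uₙ z))
          (solve 5 (λ a b c e f → ((a :- b) :+ (c :- e)) :* f := (a :* f :- b :* f) :+ (c :* f :- e :* f)) refl
                 (δ uₙ (Dout uₙ) z) (A uₙ z) (δ u₀ S z) (δ uₙ S z) (g z))

    module Distances (d : V → V → ℚ) (isD : IsDistance d) where

      d-self : ∀ x → d x x ≡ 0ℚ
      d-self = proj₁ isD

      shortest-path : ∀ a y → Σ (Path a y) λ q → Simple q × pathWeight q ≡ d a y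
      shortest-path a y with a ≟ᵥ y
      ... | yes refl = [] , [] ∷ [] , sym (d-self a)
      ... | no a≢y   = proj₁ (proj₂ isD a y a≢y)

      simple-loop-weight : ∀ {a} (q : Path a a) → Simple q → pathWeight q ≡ 0ℚ
      simple-loop-weight []      _         = refl
      simple-loop-weight (_ ∷ q) (a∉q ∷ _) = ⊥-elim (All¬⇒¬Any a∉q (end∈vertices q))

      d≤pathWeight : ∀ {a y} (q : Path a y) → Simple q → d a y Q.≤ pathWeight q
      d≤pathWeight {a} {y} q simple with a ≟ᵥ y
      ... | yes refl = QP.≤-reflexive (trans (d-self a) (sym (simple-loop-weight q simple)))
      ... | no a≢y   = proj₂ (proj₂ isD a y a≢y) q simple

      first-edge : ∀ {x y} → x ≢ y → Σ V λ b → Σ (Edge x b) λ e → Σ (Path b y) λ p →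
                   Simple p × x ∉ vertices p × d x y ≡ weight e + pathWeight p
      first-edge {x} {y} x≢y with proj₁ (proj₂ isD x y x≢y)
      ... | []    , _            , _       = ⊥-elim (x≢y refl)
      ... | e ∷ p , x∉p ∷ simple , weight≡ = _ , e , p , simple , All¬⇒¬Any x∉p , sym weight≡

      d-step : ∀ {x y} → x ≢ uₙ → x ≢ y → d x y ≡ nextWeight x + d (next x) y
      d-step {x} {y} x≢uₙ x≢y = QP.≤-antisym upper lower
        where
          upper : d x y Q.≤ nextWeight x + d (next x) y
          upper with shortest-path (next x) y
          ... | q , simple , weight≡ = begin
            d x y                         ≤⟨ proj₂ (proj₂ isD x y x≢y) (e ∷ q) (x∉q ∷ simple) ⟩
            weight e + pathWeight q       ≡⟨ cong₂ _+_ (proj₂ (edge-to-next x≢uₙ e)) weight≡ ⟩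
            nextWeight x + d (next x) y ∎
            where
              open QP.≤-Reasoning
              e = next-edge x x≢uₙ
              x∉q = ¬Any⇒All¬ (vertices q) (next-path-avoids q simple x≢y x≢uₙ)
          lower : nextWeight x + d (next x) y Q.≤ d x y
          lower with first-edge x≢y
          ... | _ , e , p , simple , _ , d≡ with edge-to-next x≢uₙ e
          ...   | refl , weight≡ = begin
            nextWeight x + d (next x) y   ≤⟨ QP.+-monoʳ-≤ (nextWeight x) (d≤pathWeight p simple) ⟩
            nextWeight x + pathWeight p   ≡⟨ cong (_+ pathWeight p) (sym weight≡) ⟩
            weight e + pathWeight p       ≡⟨ sym d≡ ⟩
            d x y ∎
            where open QP.≤-Reasoning

      d-forced : ∀ {y a b} (w : ForcedWalk y a b) → d a y ≡ cost w + d b y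
      d-forced []                               = sym (QP.+-identityˡ _)
      d-forced (step {a = a} a≢y a≢uₙ refl w) = trans (d-step a≢uₙ a≢y)
        (trans (cong (nextWeight a +_) (d-forced w)) (sym (QP.+-assoc (nextWeight a) (cost w) _)))

      d-along : ∀ {y a b φa φb} → Σ (ForcedWalk y a b) (λ w → φa + cost w ≡ φb) → d a y + φa ≡ d b y + φb
      d-along {y} {a} {b} {φa} {φb} (w , φ-cost) = begin
        d a y + φa              ≡⟨ cong (_+ φa) (d-forced w) ⟩
        (cost w + d b y) + φa   ≡⟨ solve 3 (λ c e f → (c :+ e) :+ f := e :+ (f :+ c)) refl (cost w) (d b y) φa ⟩
        d b y + (φa + cost w)   ≡⟨ cong (d b y +_) φ-cost ⟩
        d b y + φb ∎
        where open ≡-Reasoning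

      d-to-uₙ : ∀ {y} i → (∀ t → i F.≤ t → toℕ t < n → u t ≢ y) → d (u i) y + uDepth i ≡ d uₙ y + wc
      d-to-uₙ {y} i avoids = trans (d-along (line-walk u-line (FP.≤fromℕ i) avoids′)) (cong (d uₙ y +_) uDepth-uₙ)
        where avoids′ = λ t i≤t t<n → avoids t i≤t (subst (toℕ t <_) (FP.toℕ-fromℕ n) t<n)

      d-u₀ : ∀ {y} → (∀ t → toℕ t < n → u t ≢ y) → d u₀ y ≡ d uₙ y + wc
      d-u₀ avoids = trans (sym (QP.+-identityʳ _)) (d-to-uₙ F.zero λ t _ → avoids t)

      d-u₀-u : ∀ k → d u₀ (u k) ≡ uDepth k
      d-u₀-u k = begin
        d u₀ (u k)                 ≡⟨ sym (QP.+-identityʳ _) ⟩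
        d u₀ (u k) + 0ℚ            ≡⟨ d-along (line-walk u-line {u k} {F.zero} {k} z≤n before-k) ⟩
        d (u k) (u k) + uDepth k   ≡⟨ cong (_+ uDepth k) (d-self (u k)) ⟩
        0ℚ + uDepth k              ≡⟨ QP.+-identityˡ _ ⟩
        uDepth k ∎
        where
          open ≡-Reasoning
          before-k : ∀ t → F.zero {n} F.≤ t → t F.< k → u t ≢ u k
          before-k t _ t<k refl = ℕP.<-irrefl refl t<k

      d-exit : ∀ {y} j i → (∀ t → i F.≤ t → v j t ≢ y) → d (v j i) y + vDepth j i ≡ d u₀ y + ŵ j
      d-exit j i avoids = d-along (exit-walk j i avoids)

      d-v₀ : ∀ {y} j → (∀ t → v j t ≢ y) → Wb j 1 + d (v₀ j) y ≡ ŵ j + d u₀ y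
      d-v₀ {y} j avoids = begin
        Wb j 1 + d (v₀ j) y                    ≡⟨ QP.+-comm (Wb j 1) _ ⟩
        d (v₀ j) y + Wb j 1                    ≡⟨ cong (d (v₀ j) y +_) (sym (vDepth-v₀ j)) ⟩
        d (v₀ j) y + vDepth j (firstIndex j)   ≡⟨ d-exit j (firstIndex j) (λ t _ → avoids t) ⟩
        d u₀ y + ŵ j                           ≡⟨ QP.+-comm (d u₀ y) _ ⟩
        ŵ j + d u₀ y ∎
        where open ≡-Reasoning

      d-v₀-v : ∀ j i → Wb j 1 + d (v₀ j) (v j i) ≡ vDepth j i
      d-v₀-v j i = begin
        Wb j 1 + d (v₀ j) y                    ≡⟨ QP.+-comm (Wb j 1) _ ⟩
        d (v₀ j) y + Wb j 1                    ≡⟨ cong (d (v₀ j) y +_) (sym (vDepth-v₀ j)) ⟩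
        d (v₀ j) y + vDepth j (firstIndex j)   ≡⟨ d-along (line-walk (branch-line j) (firstIndex≤ j i) before-i) ⟩
        d y y + vDepth j i                     ≡⟨ cong (_+ vDepth j i) (d-self y) ⟩
        0ℚ + vDepth j i                        ≡⟨ QP.+-identityˡ _ ⟩
        vDepth j i ∎
        where
          open ≡-Reasoning
          y = v j i
          before-i : ∀ t → firstIndex j F.≤ t → t F.< i → v j t ≢ y
          before-i t _ t<i refl = ℕP.<-irrefl refl t<i

      d-uₙ-≤-via : ∀ {y} j → ForcedWalk y (v₀ j) y → y ≢ uₙ → d uₙ y Q.≤ Wb j 1 + d (v₀ j) y
      d-uₙ-≤-via {y} j walk y≢uₙ with shortest-path (v₀ j) y
      ... | q , simple , weight≡ = begin
        d uₙ y                                  ≤⟨ proj₂ (proj₂ isD uₙ y (y≢uₙ ∘ sym)) (branch-edge j ∷ q) (uₙ∉q ∷ simple) ⟩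
        weight (branch-edge j) + pathWeight q   ≡⟨ cong₂ _+_ (cong (Wb j ∘ suc) (FP.toℕ-fromℕ< (m≥1 j))) weight≡ ⟩
        Wb j 1 + d (v₀ j) y ∎
        where
          open QP.≤-Reasoning
          uₙ∉q = ¬Any⇒All¬ (vertices q) (forced-path-avoids-uₙ walk y≢uₙ q simple)

      shortest-from-uₙ : ∀ {y} → y ≢ uₙ → Σ (Fin (suc r')) λ j → Σ (Path (v₀ j) y) λ q →
                         Simple q × uₙ ∉ vertices q × d uₙ y ≡ Wb j 1 + pathWeight q
      shortest-from-uₙ y≢uₙ with first-edge (y≢uₙ ∘ sym)
      ... | _ , e , p , simple , uₙ∉p , d≡ with edge-from-uₙ refl e
      ...   | j , refl , weight≡ = j , p , simple , uₙ∉p , trans d≡ (cong (_+ pathWeight p) weight≡)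

      d-uₙ-u : Ordered → ∀ {k} → toℕ k < n → d uₙ (u k) ≡ ŵ F.zero + d u₀ (u k)
      d-uₙ-u ordered {k} k<n = QP.≤-antisym upper lower
        where
          y = u k
          upper : d uₙ y Q.≤ ŵ F.zero + d u₀ y
          upper = QP.≤-trans (d-uₙ-≤-via F.zero (proj₁ to-u₀ ++ᶠ proj₁ to-y) (u≢uₙ k<n))
                             (QP.≤-reflexive (d-v₀ F.zero λ _ ()))
            where
              to-u₀ = exit-walk F.zero (firstIndex F.zero) λ _ _ ()
              to-y = line-walk u-line {y} {F.zero} {k} z≤n λ t _ t<k → λ { refl → ℕP.<-irrefl refl t<k }
          lower : ŵ F.zero + d u₀ y Q.≤ d uₙ y
          lower with shortest-from-uₙ (u≢uₙ k<n)
          ... | j , q , simple , _ , d≡ = begin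
            ŵ F.zero + d u₀ y       ≤⟨ QP.+-monoˡ-≤ (d u₀ y) (ŵ-minimal ordered j) ⟩
            ŵ j + d u₀ y            ≡⟨ sym (d-v₀ j λ _ ()) ⟩
            Wb j 1 + d (v₀ j) y     ≤⟨ QP.+-monoʳ-≤ (Wb j 1) (d≤pathWeight q simple) ⟩
            Wb j 1 + pathWeight q   ≡⟨ sym d≡ ⟩
            d uₙ y ∎
            where open QP.≤-Reasoning

      -- Heading for branch l, any other branch would lead back through uₙ.
      d-uₙ-v : ∀ l b → d uₙ (v l b) ≡ vDepth l b
      d-uₙ-v l b = QP.≤-antisym upper lower
        where
          y = v l b
          upper : d uₙ y Q.≤ vDepth l b
          upper = QP.≤-trans (d-uₙ-≤-via l (proj₁ to-y) λ ()) (QP.≤-reflexive (d-v₀-v l b))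
            where to-y = line-walk (branch-line l) (firstIndex≤ l b) λ t _ t<b → λ { refl → ℕP.<-irrefl refl t<b }
          lower : vDepth l b Q.≤ d uₙ y
          lower with shortest-from-uₙ {y} (λ ())
          ... | j , q , simple , uₙ∉q , d≡ with j F.≟ l
          ...   | yes refl = begin
            vDepth l b              ≡⟨ sym (d-v₀-v l b) ⟩
            Wb l 1 + d (v₀ l) y     ≤⟨ QP.+-monoʳ-≤ (Wb l 1) (d≤pathWeight q simple) ⟩
            Wb l 1 + pathWeight q   ≡⟨ sym d≡ ⟩
            d uₙ y ∎
            where open QP.≤-Reasoning
          ...   | no j≢l = ⊥-elim (uₙ∉q (forced-prefix (proj₁ to-u₀ ++ᶠ proj₁ to-uₙ) q))
            where
              to-u₀ = exit-walk j (firstIndex j) λ { _ _ refl → j≢l refl }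
              to-uₙ = line-walk u-line {y} {F.zero} {fromℕ n} z≤n λ _ _ _ ()

      d-u₀-v : ∀ j i → d u₀ (v j i) ≡ vDepth j i + wc
      d-u₀-v j i = trans (d-u₀ λ _ _ ()) (cong (_+ wc) (d-uₙ-v j i))

      cycle-weight-u : Ordered → ∀ {i} → u i ≢ uₙ → d (next (u i)) (u i) + nextWeight (u i) ≡ w F.zero
      cycle-weight-u ordered {i} u≢uₙ = begin
        d (u i′) (u i) + Wᵢ
          ≡⟨ solve 3 (λ a b c → a :+ c := (a :+ (b :+ c)) :- b) refl (d (u i′) (u i)) (uDepth i) Wᵢ ⟩
        (d (u i′) (u i) + (uDepth i + Wᵢ)) - uDepth i
          ≡⟨ cong (λ t → (d (u i′) (u i) + t) - uDepth i) (proj₂ (proj₂ (u-line i i′ i′≡))) ⟩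
        (d (u i′) (u i) + uDepth i′) - uDepth i       ≡⟨ cong (_- uDepth i) (d-to-uₙ i′ after-i) ⟩
        (d uₙ (u i) + wc) - uDepth i
          ≡⟨ cong (λ t → (t + wc) - uDepth i) (trans (d-uₙ-u ordered i<n) (cong (ŵ F.zero +_) (d-u₀-u i))) ⟩
        ((ŵ F.zero + uDepth i) + wc) - uDepth i
          ≡⟨ solve 3 (λ a b c → ((a :+ b) :+ c) :- b := c :+ a) refl (ŵ F.zero) (uDepth i) wc ⟩
        wc + ŵ F.zero ∎
        where
          open ≡-Reasoning
          Wᵢ = W (suc (toℕ i))
          i<n = toℕ<n u≢uₙ
          i′ = clampedSuc i
          i′≡ = toℕ-clampedSuc i i<n
          after-i : ∀ t → i′ F.≤ t → toℕ t < n → u t ≢ u i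
          after-i t i′≤t _ refl = ℕP.<-irrefl refl (subst (ℕ._≤ toℕ t) i′≡ i′≤t)

      cycle-weight-v : ∀ j i → d (next (v j i)) (v j i) + nextWeight (v j i) ≡ w j
      cycle-weight-v j i = by-position (lastInBranch? j i)
        where
          open ≡-Reasoning
          y = v j i
          by-position : Dec (suc (toℕ i) ≡ m j) → d (next y) y + nextWeight y ≡ w j
          by-position (yes last) = begin
            d (next y) y + nextWeight y
              ≡⟨ cong₂ (λ a c → d a y + c) (proj₁ (next-v-last last)) (proj₂ (next-v-last last)) ⟩
            d u₀ y + Wb j 0               ≡⟨ cong (_+ Wb j 0) (d-u₀-v j i) ⟩
            (vDepth j i + wc) + Wb j 0
              ≡⟨ solve 3 (λ a b c → (a :+ b) :+ c := b :+ (a :+ c)) refl (vDepth j i) wc (Wb j 0) ⟩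
            wc + (vDepth j i + Wb j 0)    ≡⟨ cong (wc +_) (sym (ŵ-last j i last)) ⟩
            wc + ŵ j ∎
          by-position (no ¬last) = begin
            d (next y) y + nextWeight y                      ≡⟨ cong₂ (λ a c → d a y + c) next≡ weight≡ ⟩
            d (v j k) y + Wₖ
              ≡⟨ solve 3 (λ a b c → a :+ c := (a :+ (b :+ c)) :- b) refl (d (v j k) y) (vDepth j i) Wₖ ⟩
            (d (v j k) y + (vDepth j i + Wₖ)) - vDepth j i   ≡⟨ cong (λ t → (d (v j k) y + t) - vDepth j i) depth-step ⟩
            (d (v j k) y + vDepth j k) - vDepth j i          ≡⟨ cong (_- vDepth j i) (d-exit j k after-i) ⟩
            (d u₀ y + ŵ j) - vDepth j i                      ≡⟨ cong (λ t → (t + ŵ j) - vDepth j i) (d-u₀-v j i) ⟩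
            ((vDepth j i + wc) + ŵ j) - vDepth j i
              ≡⟨ solve 3 (λ a b c → ((a :+ b) :+ c) :- a := b :+ c) refl (vDepth j i) wc (ŵ j) ⟩
            wc + ŵ j ∎
            where
              k≡ = FP.toℕ-fromℕ< (ℕP.≤∧≢⇒< (FP.toℕ<n i) ¬last)
              k = fromℕ< (ℕP.≤∧≢⇒< (FP.toℕ<n i) ¬last)
              Wₖ = Wb j (suc (suc (toℕ i)))
              next≡ = proj₁ (next-v-inner {j} {i} {k} k≡)
              weight≡ = proj₂ (next-v-inner {j} {i} {k} k≡)
              depth-step : vDepth j i + Wₖ ≡ vDepth j k
              depth-step = trans (cong (vDepth j i +_) (sym weight≡)) (proj₂ (proj₂ (branch-line j i k k≡)))
              after-i : ∀ t → k F.≤ t → v j t ≢ y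
              after-i t k≤t refl = ℕP.<-irrefl refl (subst (ℕ._≤ toℕ t) k≡ k≤t)

      cycle-weight : Ordered → ∀ x → x ≢ uₙ → d (next x) x + nextWeight x ≡ w (cycleOf x)
      cycle-weight ordered (u i)   u≢uₙ = cycle-weight-u ordered u≢uₙ
      cycle-weight ordered (v j i) _    = cycle-weight-v j i

    module Identity (w≢0 : ∀ j → w j ≢ 0ℚ) (ordered : Ordered) (d : V → V → ℚ) (isD : IsDistance d) where
      open Distances d isD

      inv-w : ∀ j → inv (w j) * w j ≡ 1ℚ
      inv-w j = inv-inverseˡ (w j) (w≢0 j)

      identity-diagonal : ∀ {x} → x ≢ uₙ → 𝓛D d x x + I x x ≡ β x
      identity-diagonal {x} x≢uₙ = begin
        𝓛D d x x + I x x                          ≡⟨ cong₂ _+_ (𝓛-row x x≢uₙ (λ z → d z x)) (ite-yes (x ≟ᵥ x) refl) ⟩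
        c * (d x x - d (next x) x) + 1ℚ
          ≡⟨ cong₂ (λ a e → c * (a - d (next x) x) + e) (d-self x) (sym around-cycle) ⟩
        c * (0ℚ - d (next x) x) + c * (d (next x) x + nextWeight x)
          ≡⟨ solve 3 (λ c a b → c :* (con 0ℚ :- a) :+ c :* (a :+ b) := b :* c) refl c (d (next x) x) (nextWeight x) ⟩
        nextWeight x * c                          ≡⟨ sym (β-row x x≢uₙ) ⟩
        β x ∎
        where
          open ≡-Reasoning
          c = inv (w (cycleOf x))
          around-cycle : c * (d (next x) x + nextWeight x) ≡ 1ℚ
          around-cycle = trans (cong (c *_) (cycle-weight ordered x x≢uₙ)) (inv-w (cycleOf x))

      identity-off-diagonal : ∀ {x y} → x ≢ uₙ → x ≢ y → 𝓛D d x y + I x y ≡ β x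
      identity-off-diagonal {x} {y} x≢uₙ x≢y = begin
        𝓛D d x y + I x y                          ≡⟨ cong₂ _+_ (𝓛-row x x≢uₙ (λ z → d z y)) (ite-no (x ≟ᵥ y) x≢y) ⟩
        c * (d x y - d (next x) y) + 0ℚ           ≡⟨ cong (λ a → c * (a - d (next x) y) + 0ℚ) (d-step x≢uₙ x≢y) ⟩
        c * ((nextWeight x + d (next x) y) - d (next x) y) + 0ℚ
          ≡⟨ solve 3 (λ c a b → c :* ((b :+ a) :- a) :+ con 0ℚ := b :* c) refl c (d (next x) y) (nextWeight x) ⟩
        nextWeight x * c                          ≡⟨ sym (β-row x x≢uₙ) ⟩
        β x ∎
        where
          open ≡-Reasoning
          c = inv (w (cycleOf x))

      uₙ-row : V → ℚ
      uₙ-row y = Σall (λ j → inv (w j) * (d uₙ y - d (v₀ j) y)) + S * (d u₀ y - d uₙ y)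

      gap-off-branch : ∀ {y} j → (∀ t → v j t ≢ y) → d uₙ y - d (v₀ j) y ≡ Wb j 1 + ((d uₙ y - d u₀ y) - ŵ j)
      gap-off-branch {y} j avoids = begin
        d uₙ y - d (v₀ j) y
          ≡⟨ cong (λ a → d uₙ y - a) (p+q≡r⇒q≡r-p (Wb j 1) (d (v₀ j) y) _ (d-v₀ j avoids)) ⟩
        d uₙ y - ((ŵ j + d u₀ y) - Wb j 1)
          ≡⟨ solve 4 (λ a c h b → a :- ((h :+ c) :- b) := b :+ ((a :- c) :- h)) refl (d uₙ y) (d u₀ y) (ŵ j) (Wb j 1) ⟩
        Wb j 1 + ((d uₙ y - d u₀ y) - ŵ j) ∎
        where open ≡-Reasoning

      gap-own-branch : ∀ l b → d uₙ (v l b) - d (v₀ l) (v l b) ≡ Wb l 1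
      gap-own-branch l b = trans (cong (_- d (v₀ l) y) (trans (d-uₙ-v l b) (sym (d-v₀-v l b))))
                                 (solve 2 (λ a e → (a :+ e) :- e := a) refl (Wb l 1) (d (v₀ l) y))
        where y = v l b

      beyond-uₙ : ∀ {y} → (∀ t → toℕ t < n → u t ≢ y) → d uₙ y - d u₀ y ≡ - wc × d u₀ y - d uₙ y ≡ wc
      beyond-uₙ {y} avoids =
        trans (cong (λ a → d uₙ y - a) (d-u₀ avoids)) (solve 2 (λ a c → a :- (a :+ c) := :- c) refl (d uₙ y) wc) ,
        trans (cong (_- d uₙ y) (d-u₀ avoids)) (solve 2 (λ a c → (a :+ c) :- a := c) refl (d uₙ y) wc)

      branch-term-beyond-uₙ : ∀ {y} j → (∀ t → v j t ≢ y) → d uₙ y - d u₀ y ≡ - wc →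
                              inv (w j) * (d uₙ y - d (v₀ j) y) ≡ Wb j 1 * inv (w j) - 1ℚ
      branch-term-beyond-uₙ {y} j avoids beyond = begin
        inv (w j) * (d uₙ y - d (v₀ j) y)                  ≡⟨ cong (inv (w j) *_) (gap-off-branch j avoids) ⟩
        inv (w j) * (Wb j 1 + ((d uₙ y - d u₀ y) - ŵ j))   ≡⟨ cong (λ a → inv (w j) * (Wb j 1 + (a - ŵ j))) beyond ⟩
        inv (w j) * (Wb j 1 + (- wc - ŵ j))
          ≡⟨ solve 4 (λ i b c h → i :* (b :+ (:- c :- h)) := b :* i :- i :* (c :+ h)) refl (inv (w j)) (Wb j 1) wc (ŵ j) ⟩
        Wb j 1 * inv (w j) - inv (w j) * w j               ≡⟨ cong (λ a → Wb j 1 * inv (w j) - a) (inv-w j) ⟩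
        Wb j 1 * inv (w j) - 1ℚ ∎
        where open ≡-Reasoning

      β-uₙ-via-w : β uₙ ≡ (Σall (λ j → Wb j 1 * inv (w j) - 1ℚ) + 1ℚ) + S * wc
      β-uₙ-via-w = begin
        β uₙ                                ≡⟨ β-uₙ ⟩
        ΣW - Σ≥2 (λ j → ŵ j * inv (w j))    ≡⟨ cong (λ a → ΣW - a) Σ≥2-ŵ-inv ⟩
        ΣW - (N - wc * S)
          ≡⟨ solve 4 (λ a n c s → a :- (n :- c :* s) := ((a :- (con 1ℚ :+ n)) :+ con 1ℚ) :+ s :* c) refl ΣW N wc S ⟩
        ((ΣW - (1ℚ + N)) + 1ℚ) + S * wc     ≡⟨ cong (λ t → (t + 1ℚ) + S * wc) (sym Σall-minus-1) ⟩
        (Σall (λ j → Wb j 1 * inv (w j) - 1ℚ) + 1ℚ) + S * wc ∎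
        where
          open ≡-Reasoning
          ΣW = Σall (λ j → Wb j 1 * inv (w j))
          N = Σ≥2 (λ _ → 1ℚ)
          ŵ-inv : ∀ j → ŵ j * inv (w j) ≡ 1ℚ - wc * inv (w j)
          ŵ-inv j = trans (solve 3 (λ h c i → h :* i := i :* (c :+ h) :- c :* i) refl (ŵ j) wc (inv (w j)))
                          (cong (_- wc * inv (w j)) (inv-w j))
          Σ≥2-ŵ-inv : Σ≥2 (λ j → ŵ j * inv (w j)) ≡ N - wc * S
          Σ≥2-ŵ-inv = trans (sum-map-cong (ŵ-inv ∘ F.suc) (allFin r'))
                            (trans (sum-map-- (λ _ → 1ℚ) (λ j → wc * inv (w (F.suc j))) (allFin r'))
                                   (cong (λ a → N - a) (sum-map-*ˡ wc (λ j → inv (w (F.suc j))) (allFin r'))))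
          Σall-minus-1 : Σall (λ j → Wb j 1 * inv (w j) - 1ℚ) ≡ ΣW - (1ℚ + N)
          Σall-minus-1 = trans (sum-map-- (λ j → Wb j 1 * inv (w j)) (λ _ → 1ℚ) (allFin (suc r')))
                               (cong (λ a → ΣW - a) (sum-allFin-suc {r'} (λ _ → 1ℚ)))

      row-at-u : ∀ {k} → toℕ k < n → uₙ-row (u k) ≡ β uₙ
      row-at-u {k} k<n = begin
        uₙ-row y                                      ≡⟨ cong₂ _+_ (sum-map-cong term (allFin (suc r'))) (cong (S *_) back) ⟩
        Σall (λ j → Wb j 1 * inv (w j) + h j) + S * (- ŵ₀)
          ≡⟨ cong (_+ S * (- ŵ₀)) (sum-map-+ (λ j → Wb j 1 * inv (w j)) h (allFin (suc r'))) ⟩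
        (ΣW + Σall h) + S * (- ŵ₀)                    ≡⟨ cong (λ t → (ΣW + t) + S * (- ŵ₀)) (sum-allFin-suc h) ⟩
        (ΣW + (h F.zero + Σ≥2 h)) + S * (- ŵ₀)        ≡⟨ cong (λ t → (ΣW + (h F.zero + t)) + S * (- ŵ₀)) Σ≥2-h ⟩
        (ΣW + ((ŵ₀ * i₀ - ŵ₀ * i₀) + (ŵ₀ * S - R))) + S * (- ŵ₀)
          ≡⟨ solve 5 (λ a b i s r → (a :+ ((b :* i :- b :* i) :+ (b :* s :- r))) :+ s :* (:- b) := a :- r)
                     refl ΣW ŵ₀ i₀ S R ⟩
        ΣW - R                                        ≡⟨ sym β-uₙ ⟩
        β uₙ ∎
        where
          open ≡-Reasoning
          y = u k
          ŵ₀ = ŵ F.zero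
          i₀ = inv (w F.zero)
          ΣW = Σall (λ j → Wb j 1 * inv (w j))
          R = Σ≥2 (λ j → ŵ j * inv (w j))
          h : Fin (suc r') → ℚ
          h j = ŵ₀ * inv (w j) - ŵ j * inv (w j)
          Σ≥2-h : Σ≥2 h ≡ ŵ₀ * S - R
          Σ≥2-h = trans (sum-map-- (λ j → ŵ₀ * inv (w (F.suc j))) (λ j → ŵ (F.suc j) * inv (w (F.suc j))) (allFin r'))
                        (cong (_- R) (sum-map-*ˡ ŵ₀ (λ j → inv (w (F.suc j))) (allFin r')))
          ahead : d uₙ y - d u₀ y ≡ ŵ₀
          ahead = trans (cong (_- d u₀ y) (d-uₙ-u ordered k<n)) (solve 2 (λ a c → (a :+ c) :- c := a) refl ŵ₀ (d u₀ y))
          back : d u₀ y - d uₙ y ≡ - ŵ₀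
          back = trans (solve 2 (λ a c → c :- a := :- (a :- c)) refl (d uₙ y) (d u₀ y)) (cong -_ ahead)
          term : ∀ j → inv (w j) * (d uₙ y - d (v₀ j) y) ≡ Wb j 1 * inv (w j) + h j
          term j = trans (cong (inv (w j) *_) (trans (gap-off-branch j λ _ ()) (cong (λ a → Wb j 1 + (a - ŵ j)) ahead)))
                         (solve 4 (λ i b a e → i :* (b :+ (a :- e)) := b :* i :+ (a :* i :- e :* i))
                                refl (inv (w j)) (Wb j 1) ŵ₀ (ŵ j))

      row-at-uₙ : uₙ-row uₙ + 1ℚ ≡ β uₙ
      row-at-uₙ = begin
        uₙ-row uₙ + 1ℚ
          ≡⟨ cong (_+ 1ℚ) (cong₂ _+_ (sum-map-cong term (allFin (suc r'))) (cong (S *_) (proj₂ beyond))) ⟩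
        (Σall (λ j → Wb j 1 * inv (w j) - 1ℚ) + S * wc) + 1ℚ
          ≡⟨ solve 3 (λ a s c → (a :+ s :* c) :+ con 1ℚ := (a :+ con 1ℚ) :+ s :* c)
                     refl (Σall (λ j → Wb j 1 * inv (w j) - 1ℚ)) S wc ⟩
        (Σall (λ j → Wb j 1 * inv (w j) - 1ℚ) + 1ℚ) + S * wc
          ≡⟨ sym β-uₙ-via-w ⟩
        β uₙ ∎
        where
          open ≡-Reasoning
          beyond = beyond-uₙ {uₙ} λ t t<n → u≢uₙ t<n
          term = λ j → branch-term-beyond-uₙ j (λ _ ()) (proj₁ beyond)

      row-at-v : ∀ l b → uₙ-row (v l b) ≡ β uₙ
      row-at-v l b = begin
        uₙ-row y
          ≡⟨ cong₂ _+_ (sum-map-cong term (allFin (suc r'))) (cong (S *_) (proj₂ beyond)) ⟩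
        Σall (λ j → (Wb j 1 * inv (w j) - 1ℚ) + own j) + S * wc
          ≡⟨ cong (_+ S * wc) (sum-map-+ (λ j → Wb j 1 * inv (w j) - 1ℚ) own (allFin (suc r'))) ⟩
        (Σall (λ j → Wb j 1 * inv (w j) - 1ℚ) + Σall own) + S * wc
          ≡⟨ cong (λ t → (Σall (λ j → Wb j 1 * inv (w j) - 1ℚ) + t) + S * wc) own-sum ⟩
        (Σall (λ j → Wb j 1 * inv (w j) - 1ℚ) + 1ℚ) + S * wc
          ≡⟨ sym β-uₙ-via-w ⟩
        β uₙ ∎
        where
          open ≡-Reasoning
          y = v l b
          beyond = beyond-uₙ {y} λ _ _ ()
          own : Fin (suc r') → ℚ
          own j = ite (l F.≟ j) 1ℚ 0ℚ
          own-sum : Σall own ≡ 1ℚ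
          own-sum = trans (sum-allFin-support l own λ j j≢l → ite-no (l F.≟ j) (j≢l ∘ sym)) (ite-yes (l F.≟ l) refl)
          term : ∀ j → inv (w j) * (d uₙ y - d (v₀ j) y) ≡ (Wb j 1 * inv (w j) - 1ℚ) + own j
          term j with l F.≟ j
          ... | yes refl = trans (cong (inv (w l) *_) (gap-own-branch l b))
                                 (solve 2 (λ i a → i :* a := (a :* i :- con 1ℚ) :+ con 1ℚ) refl (inv (w l)) (Wb l 1))
          ... | no l≢j   = trans (branch-term-beyond-uₙ j (λ { _ refl → l≢j refl }) (proj₁ beyond)) (sym (QP.+-identityʳ _))

      identity-at-uₙ : ∀ y → 𝓛D d uₙ y + I uₙ y ≡ β uₙ
      identity-at-uₙ y = trans (cong (_+ I uₙ y) (𝓛-row-uₙ (λ z → d z y))) (by-target y)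
        where
          by-target : ∀ y → uₙ-row y + I uₙ y ≡ β uₙ
          by-target (v l b) = trans (cong (uₙ-row (v l b) +_) (ite-no (uₙ ≟ᵥ v l b) {1ℚ} {0ℚ} λ ()))
                                    (trans (QP.+-identityʳ _) (row-at-v l b))
          by-target (u k) with u k ≟ᵥ uₙ
          ... | yes refl = trans (cong (uₙ-row uₙ +_) (ite-yes (uₙ ≟ᵥ uₙ) refl)) row-at-uₙ
          ... | no u≢uₙ  = trans (cong (uₙ-row (u k) +_) (ite-no (uₙ ≟ᵥ u k) (u≢uₙ ∘ sym)))
                                 (trans (QP.+-identityʳ _) (row-at-u (toℕ<n u≢uₙ)))

mainTheorem16 : (n r' : ℕ) (m : Fin (suc r') → ℕ) (W : ℕ → ℚ) (Wb : Fin (suc r') → ℕ → ℚ) →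
    let open DC n r' m W Wb in
    1 ≤ n → (∀ j → 1 ≤ m j) →
    (∀ j → w j ≢ 0ℚ) →
    (∀ (j k : Fin (suc r')) → j Data.Fin.≤ k → w j Data.Rational.≤ w k) →
    (d : V → V → ℚ) → IsDistance d →
    ∀ x y → 𝓛D d x y Data.Rational.+ I x y ≡ β x
mainTheorem16 n r' m W Wb n≥1 m≥1 w≢0 ordered d isD x y = case x ≟ᵥ uₙ of λ where
    (yes refl) → identity-at-uₙ y
    (no x≢uₙ)  → case x ≟ᵥ y of λ where
      (yes refl) → identity-diagonal x≢uₙ
      (no x≢y)   → identity-off-diagonal x≢uₙ x≢y
  where
    open Graph n r' m W Wb
    open NonTrivial n≥1 m≥1
    open Identity w≢0 ordered d isD
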